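{- Let $n\geq 2$ be an integer and let $p_{\min}$ be its smallest prime divisor. Then \[\frac{\log n}{\log p_{\min}}\geq \sum_{p}(p-1)\,\nu_p(d(n)),\] where the sum runs over all prime numbers $p$.
   Context: $d(n)$ denotes the number of positive divisors of $n$, and $\nu_p(m)$ denotes the exponent of the prime $p$ in the prime factorization of the positive integer $m$. -}

module Defs where

open import Data.Nat using (ℕ; zero; suc; _∸_; _*_)
open import Data.Nat.Divisibility using (_∣_; _∣?_; divides)
open import Data.Nat.Primality using (prime?)
open import Data.List using (List; length; filter; map; upTo)
open import Data.Nat.ListAction using (sum)
open import Relation.Nullary using (yes; no)

-- d(n) : number of positive divisors of n (divisors lie in 1..n for n ≥ 1)
divisorCount : ℕ → ℕ
divisorCount n = length (filter (λ k → suc k ∣? n) (upTo n))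

valAux : ℕ → ℕ → ℕ → ℕ
valAux zero    p m = 0
valAux (suc f) p m with p ∣? m
... | yes (divides q _) = suc (valAux f p q)
... | no  _             = 0

-- ν_p(m) for prime p and m ≥ 1 (fuel m suffices since each quotient is < m)
ν : ℕ → ℕ → ℕ
ν p m = valAux m p m

-- Σ over primes p of (p - 1) ν_p(m), for m ≥ 1.
-- Primes p > m have ν_p(m) = 0, so it suffices to sum over primes p ≤ m.
primeWeightedSum : ℕ → ℕ
primeWeightedSum m = sum (map (λ p → (p ∸ 1) * ν p m) (filter prime? (upTo (suc m))))

module Submission where

-- Write W(m) = Σ_p (p − 1) ν_p(m). Multiplying by a prime p adds exactly p − 1 to W, so
-- factoring x into primes gives W(x y) ≤ (x − 1) + W(y), since (p − 1) + (x′ − 1) ≤ p x′ − 1.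
-- If n = q^a m with q prime and q ∤ m, then d(n) = (a + 1) d(m), hence W(d(n)) ≤ a + W(d(m));
-- as p_min^a ≤ q^a, strong induction on n gives p_min^W(d(n)) ≤ n, the theorem exponentiated.

open import Data.Bool using (true; false; if_then_else_)
open import Data.List using (List; []; _∷_; length; filter; map; upTo; _++_; [_])
open import Data.List.Properties using (upTo-∷ʳ; filter-++; map-++)
open import Data.List.Relation.Unary.All using (All; []; _∷_)
open import Data.Nat
open import Data.Nat.Coprimality using (Coprime; coprime-divisor)
open import Data.Nat.Divisibility
open import Data.Nat.Induction using (<-wellFounded)
open import Data.Nat.ListAction using (sum; product)
open import Data.Nat.ListAction.Properties using (sum-++)
open import Data.Nat.Primality
  using (Prime; prime?; prime⇒irreducible; prime⇒nonTrivial; prime⇒nonZero; euclidsLemma; productOfPrimes≢0)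
open import Data.Nat.Primality.Factorisation using (factorise)
open import Data.Nat.Properties
open import Algebra.Properties.CommutativeSemigroup +-commutativeSemigroup using (interchange)
open import Data.Product using (∃; ∃₂; _×_; _,_)
open import Data.Sum using (inj₁; inj₂; [_,_]′)
open import Function using (_∘_)
open import Function.Bundles using (mk⇔)
open import Induction.WellFounded using (Acc; acc)
open import Relation.Binary.PropositionalEquality hiding ([_])
open import Relation.Nullary using (Dec; does; yes; no; ¬_; contradiction)
open import Relation.Nullary.Decidable using (dec-true; dec-false; does-⇔)
open import Relation.Unary using (Pred; Decidable)

open import Defs

sumBelow : ℕ → (ℕ → ℕ) → ℕ
sumBelow zero    h = 0
sumBelow (suc N) h = sumBelow N h + h N

sumBelow-cong : ∀ N {h h′ : ℕ → ℕ} → (∀ {k} → k < N → h k ≡ h′ k) →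
                sumBelow N h ≡ sumBelow N h′
sumBelow-cong zero    eq = refl
sumBelow-cong (suc N) eq = cong₂ _+_ (sumBelow-cong N (λ k<N → eq (m<n⇒m<1+n k<N))) (eq ≤-refl)

sumBelow-+ : ∀ N (h h′ : ℕ → ℕ) →
             sumBelow N (λ k → h k + h′ k) ≡ sumBelow N h + sumBelow N h′
sumBelow-+ zero    h h′ = refl
sumBelow-+ (suc N) h h′ = trans (cong (_+ (h N + h′ N)) (sumBelow-+ N h h′))
                                (interchange (sumBelow N h) (sumBelow N h′) (h N) (h′ N))

sumBelow-+-vanishing : ∀ M i (h : ℕ → ℕ) → (∀ {j} → j < i → h (M + j) ≡ 0) →
                       sumBelow (M + i) h ≡ sumBelow M h
sumBelow-+-vanishing M zero    h vanish = cong (λ N → sumBelow N h) (+-identityʳ M)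
sumBelow-+-vanishing M (suc i) h vanish = begin
  sumBelow (M + suc i) h
    ≡⟨ cong (λ N → sumBelow N h) (+-suc M i) ⟩
  sumBelow (M + i) h + h (M + i)
    ≡⟨ cong₂ _+_ (sumBelow-+-vanishing M i h (λ j<i → vanish (m<n⇒m<1+n j<i))) (vanish ≤-refl) ⟩
  sumBelow M h + 0
    ≡⟨ +-identityʳ _ ⟩
  sumBelow M h ∎
  where open ≡-Reasoning

sumBelow-vanishing : ∀ {M N} (h : ℕ → ℕ) → M ≤ N → (∀ {k} → M ≤ k → k < N → h k ≡ 0) →
                     sumBelow N h ≡ sumBelow M h
sumBelow-vanishing {M} h M≤N vanish with m≤n⇒∃[o]m+o≡n M≤N
... | i , refl = sumBelow-+-vanishing M i h (λ j<i → vanish (m≤m+n M _) (+-monoʳ-< M j<i))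

sumBelow-single : ∀ {p N} c → p < N → sumBelow N (λ k → if does (k ≟ p) then c else 0) ≡ c
sumBelow-single {p} {N} c p<N = begin
  sumBelow N δ             ≡⟨ sumBelow-vanishing δ p<N (λ p<k _ → δ-off (>⇒≢ p<k)) ⟩
  sumBelow p δ + δ p       ≡⟨ cong₂ _+_ (sumBelow-vanishing δ z≤n (λ _ k<p → δ-off (<⇒≢ k<p))) δ-on ⟩
  c                        ∎
  where
  open ≡-Reasoning
  δ : ℕ → ℕ
  δ k = if does (k ≟ p) then c else 0
  δ-off : ∀ {k} → k ≢ p → δ k ≡ 0
  δ-off {k} k≢p = cong (λ b → if b then c else 0) (dec-false (k ≟ p) k≢p)
  δ-on : δ p ≡ c
  δ-on = cong (λ b → if b then c else 0) (dec-true (p ≟ p) refl)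

sum-map-filter-upTo : ∀ {ℓ} {P : Pred ℕ ℓ} (P? : Decidable P) (g : ℕ → ℕ) N →
                      sum (map g (filter P? (upTo N))) ≡ sumBelow N (λ k → if does (P? k) then g k else 0)
sum-map-filter-upTo P? g zero    = refl
sum-map-filter-upTo P? g (suc N) = begin
  sum (map g (filter P? (upTo (suc N))))
    ≡⟨ cong (λ ks → sum (map g (filter P? ks))) (sym (upTo-∷ʳ N)) ⟩
  sum (map g (filter P? (upTo N ++ [ N ])))
    ≡⟨ cong (λ ks → sum (map g ks)) (filter-++ P? (upTo N) [ N ]) ⟩
  sum (map g (filter P? (upTo N) ++ filter P? [ N ]))
    ≡⟨ cong sum (map-++ g (filter P? (upTo N)) (filter P? [ N ])) ⟩
  sum (map g (filter P? (upTo N)) ++ map g (filter P? [ N ]))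
    ≡⟨ sum-++ (map g (filter P? (upTo N))) (map g (filter P? [ N ])) ⟩
  sum (map g (filter P? (upTo N))) + sum (map g (filter P? [ N ]))
    ≡⟨ cong₂ _+_ (sum-map-filter-upTo P? g N) last ⟩
  sumBelow (suc N) (λ k → if does (P? k) then g k else 0) ∎
  where
  open ≡-Reasoning
  last : sum (map g (filter P? [ N ])) ≡ (if does (P? N) then g N else 0)
  last with P? N
  ... | yes _ = +-identityʳ (g N)
  ... | no  _ = refl

length≡sum-map-1 : ∀ {a} {A : Set a} (xs : List A) → length xs ≡ sum (map (λ _ → 1) xs)
length≡sum-map-1 []       = refl
length≡sum-map-1 (x ∷ xs) = cong suc (length≡sum-map-1 xs)

divisorIndicator : ℕ → ℕ → ℕ
divisorIndicator n k = if does (suc k ∣? n) then 1 else 0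

sumBelow-divisorIndicator : ∀ {n} N → .{{NonZero n}} → n ≤ N →
                            sumBelow N (divisorIndicator n) ≡ divisorCount n
sumBelow-divisorIndicator {n} N n≤N = begin
  sumBelow N (divisorIndicator n)
    ≡⟨ sumBelow-vanishing (divisorIndicator n) n≤N (λ n≤k _ → noDivisor n≤k) ⟩
  sumBelow n (divisorIndicator n)
    ≡⟨ sym (sum-map-filter-upTo (λ k → suc k ∣? n) (λ _ → 1) n) ⟩
  sum (map (λ _ → 1) (filter (λ k → suc k ∣? n) (upTo n)))
    ≡⟨ sym (length≡sum-map-1 (filter (λ k → suc k ∣? n) (upTo n))) ⟩
  divisorCount n ∎
  where
  open ≡-Reasoning
  noDivisor : ∀ {k} → n ≤ k → divisorIndicator n k ≡ 0
  noDivisor {k} n≤k = cong (λ b → if b then 1 else 0) (dec-false (suc k ∣? n) (>⇒∤ (s≤s n≤k)))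

divisorCount-nonZero : ∀ n → .{{NonZero n}} → NonZero (divisorCount n)
divisorCount-nonZero (suc n) rewrite dec-true (1 ∣? suc n) (1∣ suc n) = _

-- With q = r + 1, the k with q ∣ k + 1 are the k = r + j q, since then k + 1 = (j + 1) q.
sumBelow-multiples : ∀ r N (h : ℕ → ℕ) →
                     sumBelow (N * suc r) (λ k → if does (suc r ∣? suc k) then h k else 0) ≡
                     sumBelow N (λ j → h (r + j * suc r))
sumBelow-multiples r zero    h = refl
sumBelow-multiples r (suc N) h = begin
  sumBelow (suc N * q) F
    ≡⟨ cong (λ L → sumBelow L F) (trans (+-comm q (N * q)) (+-suc (N * q) r)) ⟩
  sumBelow (N * q + r) F + F (N * q + r)
    ≡⟨ cong₂ _+_ (sumBelow-+-vanishing (N * q) r F notMultiple) lastMultiple ⟩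
  sumBelow (N * q) F + h (r + N * q)
    ≡⟨ cong (_+ h (r + N * q)) (sumBelow-multiples r N h) ⟩
  sumBelow (suc N) (λ j → h (r + j * q)) ∎
  where
  open ≡-Reasoning
  q = suc r
  F : ℕ → ℕ
  F k = if does (q ∣? suc k) then h k else 0
  notMultiple : ∀ {j} → j < r → F (N * q + j) ≡ 0
  notMultiple {j} j<r = cong (λ b → if b then h (N * q + j) else 0) (dec-false (q ∣? suc (N * q + j)) q∤)
    where
    q∤ : ¬ q ∣ suc (N * q + j)
    q∤ q∣ = <⇒≱ (s≤s j<r) (∣⇒≤ (∣m+n∣m⇒∣n (subst (q ∣_) (sym (+-suc (N * q) j)) q∣) (n∣m*n N)))
  lastMultiple : F (N * q + r) ≡ h (r + N * q)
  lastMultiple = trans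
    (cong (λ b → if b then h (N * q + r) else 0)
          (dec-true (q ∣? suc (N * q + r)) (divides (suc N) (trans (sym (+-suc (N * q) r)) (+-comm (N * q) q)))))
    (cong h (+-comm (N * q) r))

-- The divisors of q M that are multiples of q are exactly q d with d ∣ M.
sumBelow-multipleDivisors : ∀ r M .{{_ : NonZero M}} →
  sumBelow (M * suc r) (λ k → if does (suc r ∣? suc k) then divisorIndicator (suc r * M) k else 0) ≡
  divisorCount M
sumBelow-multipleDivisors r M = begin
  sumBelow (M * q) (λ k → if does (q ∣? suc k) then divisorIndicator (q * M) k else 0)
    ≡⟨ sumBelow-multiples r M (divisorIndicator (q * M)) ⟩
  sumBelow M (λ j → divisorIndicator (q * M) (r + j * q))
    ≡⟨ sumBelow-cong M (λ {j} _ → cong (λ b → if b then 1 else 0) (does-⇔ (mk⇔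
         (λ jq∣qM → *-cancelʳ-∣ q (subst (suc j * q ∣_) (*-comm q M) jq∣qM))
         (λ j∣M → subst (suc j * q ∣_) (*-comm M q) (*-monoˡ-∣ q j∣M)))
       (suc j * q ∣? q * M) (suc j ∣? M))) ⟩
  sumBelow M (divisorIndicator M)
    ≡⟨ sumBelow-divisorIndicator M ≤-refl ⟩
  divisorCount M ∎
  where
  open ≡-Reasoning
  q = suc r

∣prime^*⇒∣ : ∀ {q x} a m → Prime q → ¬ q ∣ x → x ∣ q ^ a * m → x ∣ m
∣prime^*⇒∣ zero    m q-prime q∤x x∣ = subst (_ ∣_) (+-identityʳ m) x∣
∣prime^*⇒∣ {q} {x} (suc a) m q-prime q∤x x∣ =
  ∣prime^*⇒∣ a m q-prime q∤x (coprime-divisor x⊥q (subst (x ∣_) (*-assoc q (q ^ a) m) x∣))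
  where
  x⊥q : Coprime x q
  x⊥q (d∣x , d∣q) with prime⇒irreducible q-prime d∣q
  ... | inj₁ d≡1 = d≡1
  ... | inj₂ refl = contradiction d∣x q∤x

divisorCount-prime-* : ∀ {q} a m .{{_ : NonZero m}} → Prime q → ¬ q ∣ m →
                       divisorCount (q * (q ^ a * m)) ≡ divisorCount (q ^ a * m) + divisorCount m
divisorCount-prime-* {zero}      a m () q∤m
divisorCount-prime-* {q@(suc r)} a m q-prime q∤m = begin
  divisorCount (q * M)
    ≡⟨ sym (sumBelow-divisorIndicator (M * q) (≤-reflexive (*-comm q M))) ⟩
  sumBelow (M * q) (divisorIndicator (q * M))
    ≡⟨ sumBelow-cong (M * q) (λ {k} _ → splitAtMultiples k (q ∣? suc k)) ⟩
  sumBelow (M * q) (λ k → multiplesPart k + divisorIndicator m k)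
    ≡⟨ sumBelow-+ (M * q) multiplesPart (divisorIndicator m) ⟩
  sumBelow (M * q) multiplesPart + sumBelow (M * q) (divisorIndicator m)
    ≡⟨ cong₂ _+_ (sumBelow-multipleDivisors r M) (sumBelow-divisorIndicator (M * q) m≤Mq) ⟩
  divisorCount M + divisorCount m ∎
  where
  open ≡-Reasoning
  M = q ^ a * m
  instance
    M≢0 : NonZero M
    M≢0 = m*n≢0 (q ^ a) m {{m^n≢0 q a}}
    qM≢0 : NonZero (q * M)
    qM≢0 = m*n≢0 q M
  m≤Mq : m ≤ M * q
  m≤Mq = ≤-trans (∣⇒≤ (n∣m*n (q ^ a))) (m≤m*n M q)
  multiplesPart : ℕ → ℕ
  multiplesPart k = if does (q ∣? suc k) then divisorIndicator (q * M) k else 0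
  splitAtMultiples : ∀ k (q∣? : Dec (q ∣ suc k)) →
    divisorIndicator (q * M) k ≡ (if does q∣? then divisorIndicator (q * M) k else 0) + divisorIndicator m k
  splitAtMultiples k (yes q∣) = sym (trans (cong (divisorIndicator (q * M) k +_)
      (cong (λ b → if b then 1 else 0) (dec-false (suc k ∣? m) (λ k∣m → q∤m (∣-trans q∣ k∣m)))))
    (+-identityʳ _))
  splitAtMultiples k (no q∤) = cong (λ b → if b then 1 else 0) (does-⇔ (mk⇔
      (λ k∣qM → ∣prime^*⇒∣ (suc a) m q-prime q∤ (subst (suc k ∣_) (sym (*-assoc q (q ^ a) m)) k∣qM))
      (∣n⇒∣m*n q ∘ ∣n⇒∣m*n (q ^ a)))
    (suc k ∣? q * M) (suc k ∣? m))

divisorCount-prime^-* : ∀ {q} a m .{{_ : NonZero m}} → Prime q → ¬ q ∣ m →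
                        divisorCount (q ^ a * m) ≡ suc a * divisorCount m
divisorCount-prime^-* zero    m q-prime q∤m = trans (cong divisorCount (+-identityʳ m)) (sym (+-identityʳ _))
divisorCount-prime^-* {q} (suc a) m q-prime q∤m = begin
  divisorCount (q * q ^ a * m)                  ≡⟨ cong divisorCount (*-assoc q (q ^ a) m) ⟩
  divisorCount (q * (q ^ a * m))                ≡⟨ divisorCount-prime-* a m q-prime q∤m ⟩
  divisorCount (q ^ a * m) + divisorCount m     ≡⟨ cong (_+ divisorCount m) (divisorCount-prime^-* a m q-prime q∤m) ⟩
  suc a * divisorCount m + divisorCount m       ≡⟨ +-comm (suc a * divisorCount m) _ ⟩
  suc (suc a) * divisorCount m                  ∎
  where open ≡-Reasoning

∤⇒nonZero : ∀ {d m} → ¬ d ∣ m → NonZero m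
∤⇒nonZero {d} {zero}  d∤0 = contradiction (d ∣0) d∤0
∤⇒nonZero {d} {suc m} _   = _

prime>1 : ∀ {p} → Prime p → 1 < p
prime>1 {p} p-prime = nonTrivial⇒n>1 p {{prime⇒nonTrivial p-prime}}

valAux-∤ : ∀ {p m} f → ¬ p ∣ m → valAux f p m ≡ 0
valAux-∤ zero    _ = refl
valAux-∤ {p} {m} (suc f) p∤m with p ∣? m
... | yes p∣m = contradiction p∣m p∤m
... | no  _   = refl

ν-∤ : ∀ {p m} → ¬ p ∣ m → ν p m ≡ 0
ν-∤ {m = m} = valAux-∤ m

module _ {p : ℕ} (1<p : 1 < p) where

  private instance
    p≢0 : NonZero p
    p≢0 = >-nonZero (<-trans z<s 1<p)

  -- Each division by p shrinks a positive argument, so fuel m suffices and any larger fuel agrees.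
  valAux-fuel : ∀ {f g} m .{{_ : NonZero m}} → m ≤ f → m ≤ g → valAux f p m ≡ valAux g p m
  valAux-fuel {suc f} {suc g} m m≤f m≤g with p ∣? m
  ... | no  _ = refl
  ... | yes (divides q refl) = cong suc (valAux-fuel q (shrink m≤f) (shrink m≤g))
    where
    instance
      q≢0 : NonZero q
      q≢0 = m*n≢0⇒m≢0 q
    shrink : ∀ {h} → q * p ≤ suc h → q ≤ h
    shrink q*p≤1+h = ≤-pred (≤-trans (m<m*n q p 1<p) q*p≤1+h)
  valAux-fuel {zero}  {_}     (suc m) () _
  valAux-fuel {suc f} {zero}  (suc m) _ ()

  valAux-*-self : ∀ f q → valAux (suc f) p (q * p) ≡ suc (valAux f p q)
  valAux-*-self f q with p ∣? q * p
  ... | no p∤qp = contradiction (n∣m*n q) p∤qp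
  ... | yes (divides q′ eq) =
    cong (λ x → suc (valAux f p x)) (sym (*-cancelʳ-≡ q q′ p eq))

  ν-*-self : ∀ q .{{_ : NonZero q}} → ν p (q * p) ≡ suc (ν p q)
  ν-*-self q = begin
    valAux (q * p) p (q * p)        ≡⟨ valAux-fuel (q * p) {{m*n≢0 q p}} ≤-refl (n≤1+n _) ⟩
    valAux (suc (q * p)) p (q * p)  ≡⟨ valAux-*-self (q * p) q ⟩
    suc (valAux (q * p) p q)        ≡⟨ cong suc (valAux-fuel q (m≤m*n q p) ≤-refl) ⟩
    suc (valAux q p q)              ∎
    where open ≡-Reasoning

ν-prime-* : ∀ {p} → Prime p → ∀ z .{{_ : NonZero z}} → ν p (p * z) ≡ suc (ν p z)
ν-prime-* {p} p-prime z = trans (cong (ν p) (*-comm p z)) (ν-*-self (prime>1 p-prime) z)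

ν-*-∤ : ∀ {r p} → Prime r → ¬ r ∣ p → ∀ z .{{_ : NonZero z}} → ν r (p * z) ≡ ν r z
ν-*-∤ {r} {p} r-prime r∤p z = go z (<-wellFounded z)
  where
  1<r = prime>1 r-prime
  instance
    p≢0 : NonZero p
    p≢0 = ∤⇒nonZero r∤p
  go : ∀ z .{{_ : NonZero z}} → Acc _<_ z → ν r (p * z) ≡ ν r z
  go z (acc rec) with r ∣? z
  ... | no r∤z = trans (ν-∤ r∤pz) (sym (ν-∤ r∤z))
    where
    r∤pz : ¬ r ∣ p * z
    r∤pz r∣pz = [ r∤p , r∤z ]′ (euclidsLemma p z r-prime r∣pz)
  ... | yes (divides z′ refl) = begin
    ν r (p * (z′ * r))  ≡⟨ cong (ν r) (sym (*-assoc p z′ r)) ⟩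
    ν r (p * z′ * r)    ≡⟨ ν-*-self 1<r (p * z′) {{m*n≢0 p z′}} ⟩
    suc (ν r (p * z′))  ≡⟨ cong suc (go z′ (rec (m<m*n z′ r 1<r))) ⟩
    suc (ν r z′)        ≡⟨ sym (ν-*-self 1<r z′) ⟩
    ν r (z′ * r)        ∎
    where
    open ≡-Reasoning
    instance
      z′≢0 : NonZero z′
      z′≢0 = m*n≢0⇒m≢0 z′

prime≢⇒∤ : ∀ {r p} → Prime r → Prime p → r ≢ p → ¬ r ∣ p
prime≢⇒∤ r-prime p-prime r≢p r∣p with prime⇒irreducible p-prime r∣p
... | inj₁ r≡1 = <⇒≢ (prime>1 r-prime) (sym r≡1)
... | inj₂ r≡p = r≢p r≡p

primeWeight : ℕ → ℕ → ℕ
primeWeight m r = if does (prime? r) then (r ∸ 1) * ν r m else 0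

primeWeightedSum≡sumBelow : ∀ m → primeWeightedSum m ≡ sumBelow (suc m) (primeWeight m)
primeWeightedSum≡sumBelow m = sum-map-filter-upTo prime? (λ r → (r ∸ 1) * ν r m) (suc m)

>⇒primeWeight≡0 : ∀ {m r} .{{_ : NonZero m}} → m < r → primeWeight m r ≡ 0
>⇒primeWeight≡0 {m} {r} m<r with does (prime? r)
... | false = refl
... | true  = trans (cong ((r ∸ 1) *_) (ν-∤ (>⇒∤ m<r))) (*-zeroʳ (r ∸ 1))

primeWeight-prime-* : ∀ {p} → Prime p → ∀ z .{{_ : NonZero z}} r →
                      primeWeight (p * z) r ≡ primeWeight z r + (if does (r ≟ p) then p ∸ 1 else 0)
primeWeight-prime-* {p} p-prime z r with r ≟ p
... | yes refl rewrite dec-true (prime? p) p-prime | dec-true (p ≟ p) refl = begin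
  (p ∸ 1) * ν p (p * z)       ≡⟨ cong ((p ∸ 1) *_) (ν-prime-* p-prime z) ⟩
  (p ∸ 1) * suc (ν p z)       ≡⟨ *-suc (p ∸ 1) (ν p z) ⟩
  (p ∸ 1) + (p ∸ 1) * ν p z   ≡⟨ +-comm (p ∸ 1) _ ⟩
  (p ∸ 1) * ν p z + (p ∸ 1)   ∎
  where open ≡-Reasoning
... | no r≢p rewrite dec-false (r ≟ p) r≢p with prime? r
...   | no  _       = refl
...   | yes r-prime = trans (cong ((r ∸ 1) *_) (ν-*-∤ r-prime (prime≢⇒∤ r-prime p-prime r≢p) z))
                            (sym (+-identityʳ _))

primeWeightedSum-prime-* : ∀ {p} → Prime p → ∀ z .{{_ : NonZero z}} →
                           primeWeightedSum (p * z) ≡ (p ∸ 1) + primeWeightedSum z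
primeWeightedSum-prime-* {p} p-prime z = begin
  primeWeightedSum (p * z)
    ≡⟨ primeWeightedSum≡sumBelow (p * z) ⟩
  sumBelow (suc (p * z)) (primeWeight (p * z))
    ≡⟨ sumBelow-cong (suc (p * z)) (λ {r} _ → primeWeight-prime-* p-prime z r) ⟩
  sumBelow (suc (p * z)) (λ r → primeWeight z r + δ r)
    ≡⟨ sumBelow-+ (suc (p * z)) (primeWeight z) δ ⟩
  sumBelow (suc (p * z)) (primeWeight z) + sumBelow (suc (p * z)) δ
    ≡⟨ cong₂ _+_ (sumBelow-vanishing (primeWeight z) (s≤s (m≤n*m z p)) (λ z<r _ → >⇒primeWeight≡0 z<r))
                 (sumBelow-single (p ∸ 1) (s≤s (m≤m*n p z))) ⟩
  sumBelow (suc z) (primeWeight z) + (p ∸ 1)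
    ≡⟨ +-comm _ (p ∸ 1) ⟩
  (p ∸ 1) + sumBelow (suc z) (primeWeight z)
    ≡⟨ cong ((p ∸ 1) +_) (sym (primeWeightedSum≡sumBelow z)) ⟩
  (p ∸ 1) + primeWeightedSum z ∎
  where
  open ≡-Reasoning
  instance
    p≢0 : NonZero p
    p≢0 = prime⇒nonZero p-prime
  δ : ℕ → ℕ
  δ r = if does (r ≟ p) then p ∸ 1 else 0

[m∸1]+[n∸1]≤m*n∸1 : ∀ m n .{{_ : NonZero m}} .{{_ : NonZero n}} → (m ∸ 1) + (n ∸ 1) ≤ m * n ∸ 1
[m∸1]+[n∸1]≤m*n∸1 (suc m) (suc n) = begin
  m + n            ≡⟨ +-comm m n ⟩
  n + m            ≤⟨ +-monoʳ-≤ n (m≤m*n m (suc n)) ⟩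
  n + m * suc n    ∎
  where open ≤-Reasoning

primeWeightedSum-product-* : ∀ {ps} → All Prime ps → ∀ y .{{_ : NonZero y}} →
                             primeWeightedSum (product ps * y) ≤ (product ps ∸ 1) + primeWeightedSum y
primeWeightedSum-product-* []                          y = ≤-reflexive (cong primeWeightedSum (*-identityˡ y))
primeWeightedSum-product-* {p ∷ ps} (p-prime ∷ ps-prime) y = begin
  primeWeightedSum (p * P * y)             ≡⟨ cong primeWeightedSum (*-assoc p P y) ⟩
  primeWeightedSum (p * (P * y))           ≡⟨ primeWeightedSum-prime-* p-prime (P * y) {{m*n≢0 P y}} ⟩
  (p ∸ 1) + primeWeightedSum (P * y)       ≤⟨ +-monoʳ-≤ (p ∸ 1) (primeWeightedSum-product-* ps-prime y) ⟩
  (p ∸ 1) + ((P ∸ 1) + primeWeightedSum y) ≡⟨ +-assoc (p ∸ 1) (P ∸ 1) _ ⟨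
  (p ∸ 1) + (P ∸ 1) + primeWeightedSum y   ≤⟨ +-monoˡ-≤ (primeWeightedSum y) ([m∸1]+[n∸1]≤m*n∸1 p P) ⟩
  (p * P ∸ 1) + primeWeightedSum y         ∎
  where
  open ≤-Reasoning
  P = product ps
  instance
    p≢0 : NonZero p
    p≢0 = prime⇒nonZero p-prime
    P≢0 : NonZero P
    P≢0 = productOfPrimes≢0 ps-prime

primeWeightedSum-*-≤ : ∀ x y .{{_ : NonZero x}} .{{_ : NonZero y}} →
                       primeWeightedSum (x * y) ≤ (x ∸ 1) + primeWeightedSum y
primeWeightedSum-*-≤ x y with factorise x
... | record { isFactorisation = refl ; factorsPrime = ps-prime } = primeWeightedSum-product-* ps-prime y

primeFactor : ∀ n → 1 < n → ∃ λ q → Prime q × q ∣ n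
primeFactor n 1<n with factorise n {{>-nonZero (<-trans z<s 1<n)}}
... | record { factors = [] ; isFactorisation = n≡1 } = contradiction n≡1 (>⇒≢ 1<n)
... | record { factors = q ∷ qs ; isFactorisation = refl ; factorsPrime = q-prime ∷ _ } =
  q , q-prime , m∣m*n (product qs)

splitOffPower : ∀ {q} → 1 < q → ∀ n .{{_ : NonZero n}} → ∃₂ λ a m → n ≡ q ^ a * m × ¬ q ∣ m
splitOffPower {q} 1<q n = go n (<-wellFounded n)
  where
  go : ∀ n .{{_ : NonZero n}} → Acc _<_ n → ∃₂ λ a m → n ≡ q ^ a * m × ¬ q ∣ m
  go n (acc rec) with q ∣? n
  ... | no q∤n = 0 , n , sym (*-identityˡ n) , q∤n
  ... | yes (divides n′ refl) with go n′ {{m*n≢0⇒m≢0 n′}} (rec (m<m*n n′ q {{m*n≢0⇒m≢0 n′}} 1<q))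
  ...   | a , m , refl , q∤m = suc a , m , trans (*-comm (q ^ a * m) q) (sym (*-assoc q (q ^ a) m)) , q∤m

DivisorWeightBound : ℕ → ℕ → Set
DivisorWeightBound P n = P ^ primeWeightedSum (divisorCount n) ≤ n

divisorWeightBound-prime^-* : ∀ {P q} .{{_ : NonZero P}} a m .{{_ : NonZero m}} → Prime q → ¬ q ∣ m →
                              P ≤ q → DivisorWeightBound P m → DivisorWeightBound P (q ^ a * m)
divisorWeightBound-prime^-* {P} {q} a m q-prime q∤m P≤q bound-m = begin
  P ^ primeWeightedSum (divisorCount (q ^ a * m))
    ≡⟨ cong (λ k → P ^ primeWeightedSum k) (divisorCount-prime^-* a m q-prime q∤m) ⟩
  P ^ primeWeightedSum (suc a * divisorCount m)
    ≤⟨ ^-monoʳ-≤ P (primeWeightedSum-*-≤ (suc a) (divisorCount m) {{_}} {{divisorCount-nonZero m}}) ⟩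
  P ^ (a + primeWeightedSum (divisorCount m))
    ≡⟨ ^-distribˡ-+-* P a _ ⟩
  P ^ a * P ^ primeWeightedSum (divisorCount m)
    ≤⟨ *-mono-≤ (^-monoˡ-≤ a P≤q) bound-m ⟩
  q ^ a * m ∎
  where open ≤-Reasoning

divisorWeightBound : ∀ {P} .{{_ : NonZero P}} n .{{_ : NonZero n}} →
                     (∀ q → Prime q → q ∣ n → P ≤ q) → DivisorWeightBound P n
divisorWeightBound {P} n = go n (<-wellFounded n)
  where
  go : ∀ n .{{_ : NonZero n}} → Acc _<_ n → (∀ q → Prime q → q ∣ n → P ≤ q) → DivisorWeightBound P n
  go 1 _ _ = ≤-refl
  go n@(2+ _) (acc rec) P≤ with primeFactor n (s≤s (s≤s z≤n))
  ... | q , q-prime , q∣n with splitOffPower (prime>1 q-prime) n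
  ...   | zero  , m , n≡m , q∤m = contradiction (subst (q ∣_) (trans n≡m (*-identityˡ m)) q∣n) q∤m
  ...   | suc a , m , n≡qᵃm , q∤m =
    subst (DivisorWeightBound P) (sym n≡qᵃm)
      (divisorWeightBound-prime^-* (suc a) m q-prime q∤m (P≤ q q-prime q∣n)
        (go m (rec m<n) (λ r r-prime r∣m → P≤ r r-prime (∣-trans r∣m m∣n))))
    where
    instance
      m≢0 : NonZero m
      m≢0 = ∤⇒nonZero q∤m
    m∣n : m ∣ n
    m∣n = subst (m ∣_) (sym n≡qᵃm) (n∣m*n (q ^ suc a))
    m<n : m < n
    m<n = subst (m <_) (trans (*-comm m _) (sym n≡qᵃm))
                (m<m*n m (q ^ suc a) (^-monoʳ-< q (prime>1 q-prime) (z<s {a})))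

lemma6 : (n : ℕ) → 2 ≤ n → (pmin : ℕ) → Prime pmin → pmin ∣ n →
         ((q : ℕ) → Prime q → q ∣ n → pmin ≤ q) →
         pmin ^ primeWeightedSum (divisorCount n) ≤ n
lemma6 n 2≤n pmin pmin-prime _ pmin≤ =
  divisorWeightBound n {{>-nonZero (<-trans z<s 2≤n)}} pmin≤
  where
  instance
    pmin≢0 : NonZero pmin
    pmin≢0 = prime⇒nonZero pmin-prime
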